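{- Let $m\ge 1$ be an integer. Then \[ \sum_{r=0}^{m}(-1)^r\binom{m}{r}\binom{m+r}{r}\frac{1}{(r+1)(m+r)}=\begin{cases}1/2 & \text{if } m=1,\\ 0 & \text{if } m\ge 2.\end{cases} \] -}

module Defs where

open import Data.Nat as ℕ using (ℕ; zero; suc; NonZero)
open import Data.Nat.Combinatorics using (_C_)
open import Data.Integer as ℤ using (ℤ)
open import Data.Rational using (ℚ; _/_; _+_)

sign : ℕ → ℤ
sign zero = ℤ.+ 1
sign (suc r) = ℤ.- sign r

sumTo : ℕ → (ℕ → ℚ) → ℚ
sumTo zero f = f 0
sumTo (suc n) f = sumTo n f + f (suc n)

term : (m : ℕ) → .{{NonZero m}} → ℕ → ℚ
term (suc k) r = (sign r ℤ.* ℤ.+ ((suc k C r) ℕ.* ((suc k ℕ.+ r) C r))) / (suc r ℕ.* suc (k ℕ.+ r))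

S : (m : ℕ) → .{{NonZero m}} → ℚ
S m = sumTo m (term m)

{-# OPTIONS --safe #-}
-- Absorption, C(m,r)(m+1) = C(m+1,r+1)(r+1) and C(m+r,r) m = C(m-1+r,r)(m+r), puts every
-- summand over the common denominator m(m+1) with numerator (-1)^r C(m-1+r,r) C(m+1,r+1).
-- As C(m+1,r+1) = C(m+1,m-r), the numerators sum to the coefficient of x^m in
-- (1+x)^-m (1+x)^(m+1) = 1 + x, which vanishes for m ≥ 2. The product is computed on
-- coefficient sequences, where a factor 1 + x may be moved from one convolution factor to the other.
module Submission where

open import Defs
open import Data.Nat as ℕ using (ℕ; zero; suc; _∸_; _≤_; _≥_; NonZero; z≤n; s≤s)
import Data.Nat.Properties as ℕ
open import Data.Nat.Combinatorics using (_C_; nCk≡nC[n∸k]; nCn≡1; nC1≡n; nCk+nC[k+1]≡[n+1]C[k+1])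
import Data.Nat.Tactic.RingSolver as ℕ-Solver
open import Data.Integer as ℤ using (ℤ; +_; 0ℤ; -_; _+_; _*_)
import Data.Integer.Properties as ℤ
open import Algebra.Properties.CommutativeSemigroup ℤ.+-commutativeSemigroup using () renaming (interchange to +-interchange)
import Data.Integer.Tactic.RingSolver as ℤ-Solver
open import Data.Rational as ℚ using (½; 0ℚ; _/_; toℚᵘ)
import Data.Rational.Properties as ℚ
open import Data.Rational.Unnormalised as ℚᵘ using (mkℚᵘ; *≡*)
import Data.Rational.Unnormalised.Properties as ℚᵘ
open import Data.Product using (_×_; _,_)
open import Function using (const; _∘_)
open import Relation.Binary.PropositionalEquality
import Relation.Binary.Reasoning.Setoid as SetoidReasoning

nC0≡1 : ∀ n → n C 0 ≡ 1
nC0≡1 n = trans (nCk≡nC[n∸k] (z≤n {n})) (nCn≡1 n)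

[m+n]Cm≡[m+n]Cn : ∀ m n → (m ℕ.+ n) C m ≡ (m ℕ.+ n) C n
[m+n]Cm≡[m+n]Cn m n = trans (nCk≡nC[n∸k] (ℕ.m≤m+n m n)) (cong ((m ℕ.+ n) C_) (ℕ.m+n∸m≡n m n))

[k+1]*[n+1]C[k+1]≡[n+1]*nCk : ∀ n k → suc k ℕ.* (suc n C suc k) ≡ suc n ℕ.* (n C k)
[k+1]*[n+1]C[k+1]≡[n+1]*nCk zero zero = refl
[k+1]*[n+1]C[k+1]≡[n+1]*nCk zero (suc k) = ℕ.*-zeroʳ (suc (suc k))
[k+1]*[n+1]C[k+1]≡[n+1]*nCk (suc n) zero = begin
  1 ℕ.* (suc (suc n) C 1)  ≡⟨ trans (ℕ.*-identityˡ _) (nC1≡n (suc (suc n))) ⟩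
  suc (suc n)              ≡⟨ trans (cong (suc (suc n) ℕ.*_) (nC0≡1 (suc n))) (ℕ.*-identityʳ _) ⟨
  suc (suc n) ℕ.* (suc n C 0) ∎
  where open ≡-Reasoning
[k+1]*[n+1]C[k+1]≡[n+1]*nCk (suc n) (suc k) = begin
  suc (suc k) ℕ.* (suc (suc n) C suc (suc k))
    ≡⟨ cong (suc (suc k) ℕ.*_) (nCk+nC[k+1]≡[n+1]C[k+1] (suc n) (suc k)) ⟨
  suc (suc k) ℕ.* (a ℕ.+ b)
    ≡⟨ expand a b (suc k) ⟩
  a ℕ.+ suc k ℕ.* a ℕ.+ suc (suc k) ℕ.* b
    ≡⟨ cong₂ (λ x y → a ℕ.+ x ℕ.+ y) ([k+1]*[n+1]C[k+1]≡[n+1]*nCk n k) ([k+1]*[n+1]C[k+1]≡[n+1]*nCk n (suc k)) ⟩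
  a ℕ.+ suc n ℕ.* (n C k) ℕ.+ suc n ℕ.* (n C suc k)
    ≡⟨ collect a (suc n) (n C k) (n C suc k) ⟩
  a ℕ.+ suc n ℕ.* (n C k ℕ.+ n C suc k)
    ≡⟨ cong (λ x → a ℕ.+ suc n ℕ.* x) (nCk+nC[k+1]≡[n+1]C[k+1] n k) ⟩
  suc (suc n) ℕ.* a ∎
  where
  open ≡-Reasoning
  a = suc n C suc k
  b = suc n C suc (suc k)
  expand : ∀ a b k → suc k ℕ.* (a ℕ.+ b) ≡ a ℕ.+ k ℕ.* a ℕ.+ suc k ℕ.* b
  expand = ℕ-Solver.solve-∀
  collect : ∀ a n c d → a ℕ.+ n ℕ.* c ℕ.+ n ℕ.* d ≡ a ℕ.+ n ℕ.* (c ℕ.+ d)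
  collect = ℕ-Solver.solve-∀

[m+1]*[m+1+n]Cn≡[m+n+1]*[m+n]Cn : ∀ m n → suc m ℕ.* ((suc m ℕ.+ n) C n) ≡ suc (m ℕ.+ n) ℕ.* ((m ℕ.+ n) C n)
[m+1]*[m+1+n]Cn≡[m+n+1]*[m+n]Cn m n = begin
  suc m ℕ.* ((suc m ℕ.+ n) C n)     ≡⟨ cong (suc m ℕ.*_) ([m+n]Cm≡[m+n]Cn (suc m) n) ⟨
  suc m ℕ.* (suc (m ℕ.+ n) C suc m) ≡⟨ [k+1]*[n+1]C[k+1]≡[n+1]*nCk (m ℕ.+ n) m ⟩
  suc (m ℕ.+ n) ℕ.* ((m ℕ.+ n) C m) ≡⟨ cong (suc (m ℕ.+ n) ℕ.*_) ([m+n]Cm≡[m+n]Cn m n) ⟩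
  suc (m ℕ.+ n) ℕ.* ((m ℕ.+ n) C n) ∎
  where open ≡-Reasoning

summand-numerator-identity : ∀ k r →
  ((suc k C r) ℕ.* ((suc k ℕ.+ r) C r)) ℕ.* (suc k ℕ.* suc (suc k))
    ≡ (((k ℕ.+ r) C r) ℕ.* (suc (suc k) C suc r)) ℕ.* (suc r ℕ.* suc (k ℕ.+ r))
summand-numerator-identity k r = begin
  ((suc k C r) ℕ.* ((suc k ℕ.+ r) C r)) ℕ.* (suc k ℕ.* suc (suc k))
    ≡⟨ regroup (suc k C r) ((suc k ℕ.+ r) C r) (suc k) (suc (suc k)) ⟩
  (suc (suc k) ℕ.* (suc k C r)) ℕ.* (suc k ℕ.* ((suc k ℕ.+ r) C r))
    ≡⟨ cong₂ ℕ._*_ (sym ([k+1]*[n+1]C[k+1]≡[n+1]*nCk (suc k) r)) ([m+1]*[m+1+n]Cn≡[m+n+1]*[m+n]Cn k r) ⟩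
  (suc r ℕ.* (suc (suc k) C suc r)) ℕ.* (suc (k ℕ.+ r) ℕ.* ((k ℕ.+ r) C r))
    ≡⟨ regroup′ (suc r) (suc (suc k) C suc r) (suc (k ℕ.+ r)) ((k ℕ.+ r) C r) ⟩
  (((k ℕ.+ r) C r) ℕ.* (suc (suc k) C suc r)) ℕ.* (suc r ℕ.* suc (k ℕ.+ r)) ∎
  where
  open ≡-Reasoning
  regroup : ∀ x y a b → (x ℕ.* y) ℕ.* (a ℕ.* b) ≡ (b ℕ.* x) ℕ.* (a ℕ.* y)
  regroup = ℕ-Solver.solve-∀
  regroup′ : ∀ a x b y → (a ℕ.* x) ℕ.* (b ℕ.* y) ≡ (y ℕ.* x) ℕ.* (a ℕ.* b)
  regroup′ = ℕ-Solver.solve-∀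

Series : Set
Series = ℕ → ℤ

δ : Series
δ zero    = + 1
δ (suc _) = 0ℤ

shift : Series → Series
shift f zero    = 0ℤ
shift f (suc j) = f j

infixr 9 1+x*_

1+x*_ : Series → Series
(1+x* f) j = f j + shift f j

conv : Series → Series → Series
conv f g zero    = f 0 * g 0
conv f g (suc k) = f 0 * g (suc k) + conv (f ∘ suc) g k

conv-cong : ∀ {f f′ g g′} → f ≗ f′ → g ≗ g′ → conv f g ≗ conv f′ g′
conv-cong f≗f′ g≗g′ zero    = cong₂ _*_ (f≗f′ 0) (g≗g′ 0)
conv-cong f≗f′ g≗g′ (suc k) =
  cong₂ _+_ (cong₂ _*_ (f≗f′ 0) (g≗g′ (suc k))) (conv-cong (f≗f′ ∘ suc) g≗g′ k)

conv-zeroˡ : ∀ g → conv (const 0ℤ) g ≗ const 0ℤ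
conv-zeroˡ g zero    = refl
conv-zeroˡ g (suc k) = trans (ℤ.+-identityˡ _) (conv-zeroˡ g k)

conv-identityˡ : ∀ g → conv δ g ≗ g
conv-identityˡ g zero    = ℤ.*-identityˡ (g 0)
conv-identityˡ g (suc k) =
  trans (cong₂ _+_ (ℤ.*-identityˡ (g (suc k))) (conv-zeroˡ g k)) (ℤ.+-identityʳ (g (suc k)))

conv-distribˡ-+ : ∀ f g h → conv f (λ j → g j + h j) ≗ λ k → conv f g k + conv f h k
conv-distribˡ-+ f g h zero    = ℤ.*-distribˡ-+ (f 0) (g 0) (h 0)
conv-distribˡ-+ f g h (suc k) = begin
  f 0 * (g (suc k) + h (suc k)) + conv (f ∘ suc) (λ j → g j + h j) k
    ≡⟨ cong₂ _+_ (ℤ.*-distribˡ-+ (f 0) (g (suc k)) (h (suc k))) (conv-distribˡ-+ (f ∘ suc) g h k) ⟩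
  (f 0 * g (suc k) + f 0 * h (suc k)) + (conv (f ∘ suc) g k + conv (f ∘ suc) h k)
    ≡⟨ +-interchange (f 0 * g (suc k)) _ (conv (f ∘ suc) g k) _ ⟩
  conv f g (suc k) + conv f h (suc k) ∎
  where open ≡-Reasoning

conv-distribʳ-+ : ∀ f g h → conv (λ r → f r + g r) h ≗ λ k → conv f h k + conv g h k
conv-distribʳ-+ f g h zero    = ℤ.*-distribʳ-+ (h 0) (f 0) (g 0)
conv-distribʳ-+ f g h (suc k) = begin
  (f 0 + g 0) * h (suc k) + conv (λ r → f (suc r) + g (suc r)) h k
    ≡⟨ cong₂ _+_ (ℤ.*-distribʳ-+ (h (suc k)) (f 0) (g 0)) (conv-distribʳ-+ (f ∘ suc) (g ∘ suc) h k) ⟩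
  (f 0 * h (suc k) + g 0 * h (suc k)) + (conv (f ∘ suc) h k + conv (g ∘ suc) h k)
    ≡⟨ +-interchange (f 0 * h (suc k)) _ (conv (f ∘ suc) h k) _ ⟩
  conv f h (suc k) + conv g h (suc k) ∎
  where open ≡-Reasoning

conv-shiftˡ : ∀ f g → conv (shift f) g ≗ shift (conv f g)
conv-shiftˡ f g zero    = refl
conv-shiftˡ f g (suc k) = ℤ.+-identityˡ (conv f g k)

conv-shiftʳ : ∀ f g → conv f (shift g) ≗ shift (conv f g)
conv-shiftʳ f g zero          = ℤ.*-zeroʳ (f 0)
conv-shiftʳ f g (suc zero)    = trans (cong (_+_ (f 0 * g 0)) (ℤ.*-zeroʳ (f 1))) (ℤ.+-identityʳ _)
conv-shiftʳ f g (suc (suc k)) = cong (_+_ (f 0 * g (suc k))) (conv-shiftʳ (f ∘ suc) g (suc k))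

conv-1+x*-comm : ∀ f g → conv f (1+x* g) ≗ conv (1+x* f) g
conv-1+x*-comm f g k = begin
  conv f (1+x* g) k                 ≡⟨ conv-distribˡ-+ f g (shift g) k ⟩
  conv f g k + conv f (shift g) k   ≡⟨ cong (_+_ (conv f g k)) (trans (conv-shiftʳ f g k) (sym (conv-shiftˡ f g k))) ⟩
  conv f g k + conv (shift f) g k   ≡⟨ conv-distribʳ-+ f (shift f) g k ⟨
  conv (1+x* f) g k                 ∎
  where open ≡-Reasoning

sumℤ : ℕ → Series → ℤ
sumℤ zero    f = f 0
sumℤ (suc n) f = sumℤ n f + f (suc n)

sumℤ-suc : ∀ n f → sumℤ (suc n) f ≡ f 0 + sumℤ n (f ∘ suc)
sumℤ-suc zero    f = refl
sumℤ-suc (suc n) f = trans (cong (_+ f (suc (suc n))) (sumℤ-suc n f)) (ℤ.+-assoc (f 0) _ _)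

sumℤ-cong-≤ : ∀ n {f g} → (∀ r → r ≤ n → f r ≡ g r) → sumℤ n f ≡ sumℤ n g
sumℤ-cong-≤ zero    f≡g = f≡g 0 z≤n
sumℤ-cong-≤ (suc n) f≡g = cong₂ _+_ (sumℤ-cong-≤ n (λ r r≤n → f≡g r (ℕ.m≤n⇒m≤1+n r≤n))) (f≡g (suc n) ℕ.≤-refl)

conv≡sumℤ : ∀ f g k → conv f g k ≡ sumℤ k (λ r → f r * g (k ∸ r))
conv≡sumℤ f g zero    = refl
conv≡sumℤ f g (suc k) =
  trans (cong (_+_ (f 0 * g (suc k))) (conv≡sumℤ (f ∘ suc) g k)) (sym (sumℤ-suc k (λ r → f r * g (suc k ∸ r))))

-- negBinomial n and binomial n are the coefficients of (1+x)^-(n+1) and of (1+x)^n.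
negBinomial : ℕ → Series
negBinomial n r = sign r * + ((n ℕ.+ r) C r)

binomial : ℕ → Series
binomial n j = + (n C j)

1+x*-negBinomial-zero : 1+x* negBinomial 0 ≗ δ
1+x*-negBinomial-zero zero    = refl
1+x*-negBinomial-zero (suc r) = begin
  - sign r * + (suc r C suc r) + sign r * + (r C r) ≡⟨ cong₂ (λ a b → - sign r * + a + sign r * + b) (nCn≡1 (suc r)) (nCn≡1 r) ⟩
  - sign r * + 1 + sign r * + 1                     ≡⟨ cancel (sign r) ⟩
  0ℤ                                                ∎
  where
  open ≡-Reasoning
  cancel : ∀ s → - s * + 1 + s * + 1 ≡ 0ℤ
  cancel = ℤ-Solver.solve-∀

1+x*-negBinomial-suc : ∀ n → 1+x* negBinomial (suc n) ≗ negBinomial n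
1+x*-negBinomial-suc n zero    =
  trans (ℤ.+-identityʳ _) (cong (λ c → + 1 * + c) (trans (nC0≡1 (suc n ℕ.+ 0)) (sym (nC0≡1 (n ℕ.+ 0)))))
1+x*-negBinomial-suc n (suc r) = begin
  - sign r * + (suc N C suc r) + sign r * + ((suc n ℕ.+ r) C r)
    ≡⟨ cong₂ (λ a b → - sign r * + a + sign r * + b)
         (sym (nCk+nC[k+1]≡[n+1]C[k+1] N r)) (cong (_C r) (sym (ℕ.+-suc n r))) ⟩
  - sign r * + (N C r ℕ.+ N C suc r) + sign r * + (N C r)
    ≡⟨ cong (λ a → - sign r * a + sign r * + (N C r)) (ℤ.pos-+ (N C r) (N C suc r)) ⟩
  - sign r * (+ (N C r) + + (N C suc r)) + sign r * + (N C r)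
    ≡⟨ cancel (sign r) (+ (N C r)) (+ (N C suc r)) ⟩
  - sign r * + (N C suc r) ∎
  where
  open ≡-Reasoning
  N = n ℕ.+ suc r
  cancel : ∀ s a b → - s * (a + b) + s * a ≡ - s * b
  cancel = ℤ-Solver.solve-∀

binomial-zero : binomial 0 ≗ δ
binomial-zero zero    = refl
binomial-zero (suc j) = refl

binomial-suc : ∀ n → binomial (suc n) ≗ 1+x* binomial n
binomial-suc n zero    = trans (cong +_ (trans (nC0≡1 (suc n)) (sym (nC0≡1 n)))) (sym (ℤ.+-identityʳ _))
binomial-suc n (suc j) = begin
  + (suc n C suc j)             ≡⟨ cong +_ (nCk+nC[k+1]≡[n+1]C[k+1] n j) ⟨
  + (n C j ℕ.+ n C suc j)       ≡⟨ ℤ.pos-+ (n C j) (n C suc j) ⟩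
  + (n C j) + + (n C suc j)     ≡⟨ ℤ.+-comm (+ (n C j)) (+ (n C suc j)) ⟩
  + (n C suc j) + + (n C j)     ∎
  where open ≡-Reasoning

conv-negBinomial-binomial : ∀ n → conv (negBinomial n) (binomial (suc n)) ≗ δ
conv-negBinomial-binomial n = begin
  conv (negBinomial n) (binomial (suc n))      ≈⟨ conv-cong (λ _ → refl) (binomial-suc n) ⟩
  conv (negBinomial n) (1+x* binomial n)       ≈⟨ conv-1+x*-comm (negBinomial n) (binomial n) ⟩
  conv (1+x* negBinomial n) (binomial n)       ≈⟨ conv-1+x*-negBinomial-binomial n ⟩
  δ                                            ∎
  where
  open SetoidReasoning (ℕ →-setoid ℤ)
  conv-1+x*-negBinomial-binomial : ∀ n → conv (1+x* negBinomial n) (binomial n) ≗ δ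
  conv-1+x*-negBinomial-binomial zero    = begin
    conv (1+x* negBinomial 0) (binomial 0)   ≈⟨ conv-cong 1+x*-negBinomial-zero binomial-zero ⟩
    conv δ δ                                 ≈⟨ conv-identityˡ δ ⟩
    δ                                        ∎
  conv-1+x*-negBinomial-binomial (suc n) = begin
    conv (1+x* negBinomial (suc n)) (binomial (suc n)) ≈⟨ conv-cong (1+x*-negBinomial-suc n) (λ _ → refl) ⟩
    conv (negBinomial n) (binomial (suc n))            ≈⟨ conv-negBinomial-binomial n ⟩
    δ                                                  ∎

sum-negBinomial-binomial : ∀ n →
  sumℤ (suc n) (λ r → negBinomial n r * binomial (suc (suc n)) (suc r)) ≡ δ (suc n) + δ n
sum-negBinomial-binomial n = begin
  sumℤ (suc n) (λ r → negBinomial n r * binomial (suc (suc n)) (suc r))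
    ≡⟨ sumℤ-cong-≤ (suc n) (λ r r≤1+n → cong (λ c → negBinomial n r * + c) (nCk≡nC[n∸k] (s≤s r≤1+n))) ⟩
  sumℤ (suc n) (λ r → negBinomial n r * binomial (suc (suc n)) (suc n ∸ r))
    ≡⟨ conv≡sumℤ (negBinomial n) (binomial (suc (suc n))) (suc n) ⟨
  conv (negBinomial n) (binomial (suc (suc n))) (suc n)
    ≡⟨ conv-cong {negBinomial n} (λ _ → refl) (binomial-suc (suc n)) (suc n) ⟩
  conv (negBinomial n) (1+x* binomial (suc n)) (suc n)
    ≡⟨ conv-distribˡ-+ (negBinomial n) (binomial (suc n)) (shift (binomial (suc n))) (suc n) ⟩
  conv (negBinomial n) (binomial (suc n)) (suc n) + conv (negBinomial n) (shift (binomial (suc n))) (suc n)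
    ≡⟨ cong₂ _+_ (conv-negBinomial-binomial n (suc n))
                 (trans (conv-shiftʳ (negBinomial n) (binomial (suc n)) (suc n)) (conv-negBinomial-binomial n n)) ⟩
  δ (suc n) + δ n ∎
  where open ≡-Reasoning

/-cross-≡ : ∀ p q c d .{{_ : NonZero c}} .{{_ : NonZero d}} → p * + d ≡ q * + c → p / c ≡ q / d
/-cross-≡ p q (suc c) (suc d) eq = ℚ.fromℚᵘ-cong {mkℚᵘ p c} {mkℚᵘ q d} (*≡* eq)

/-distribʳ-+ : ∀ a b d .{{_ : NonZero d}} → (a + b) / d ≡ a / d ℚ.+ b / d
/-distribʳ-+ a b d@(suc d-1) = ℚ.toℚᵘ-injective (begin
  toℚᵘ ((a + b) / d)                ≈⟨ ℚ.toℚᵘ-fromℚᵘ (mkℚᵘ (a + b) d-1) ⟩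
  mkℚᵘ (a + b) d-1                  ≈⟨ *≡* common-denominator ⟩
  mkℚᵘ a d-1 ℚᵘ.+ mkℚᵘ b d-1        ≈⟨ ℚᵘ.+-cong (ℚ.toℚᵘ-fromℚᵘ (mkℚᵘ a d-1)) (ℚ.toℚᵘ-fromℚᵘ (mkℚᵘ b d-1)) ⟨
  toℚᵘ (a / d) ℚᵘ.+ toℚᵘ (b / d)    ≈⟨ ℚ.toℚᵘ-homo-+ (a / d) (b / d) ⟨
  toℚᵘ (a / d ℚ.+ b / d)            ∎)
  where
  open ℚᵘ.≃-Reasoning
  common-denominator : (a + b) * + (d ℕ.* d) ≡ (a * + d + b * + d) * + d
  common-denominator = trans (cong ((a + b) *_) (ℤ.pos-* d d)) (expand a b (+ d))
    where
    expand : ∀ a b d → (a + b) * (d * d) ≡ (a * d + b * d) * d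
    expand = ℤ-Solver.solve-∀

sumTo-cong : ∀ n {f g} → f ≗ g → sumTo n f ≡ sumTo n g
sumTo-cong zero    f≗g = f≗g 0
sumTo-cong (suc n) f≗g = cong₂ ℚ._+_ (sumTo-cong n f≗g) (f≗g (suc n))

sumTo-/ : ∀ n c d .{{_ : NonZero d}} → sumTo n (λ r → c r / d) ≡ sumℤ n c / d
sumTo-/ zero    c d = refl
sumTo-/ (suc n) c d = trans (cong (ℚ._+ c (suc n) / d) (sumTo-/ n c d)) (sym (/-distribʳ-+ (sumℤ n c) (c (suc n)) d))

term≡negBinomial*binomial/[k+1][k+2] : ∀ k r →
  term (suc k) r ≡ (negBinomial k r * binomial (suc (suc k)) (suc r)) / (suc k ℕ.* suc (suc k))
term≡negBinomial*binomial/[k+1][k+2] k r =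
  /-cross-≡ (sign r * + A) (negBinomial k r * binomial (suc (suc k)) (suc r)) (suc r ℕ.* suc (k ℕ.+ r)) (suc k ℕ.* suc (suc k)) (begin
  sign r * + A * + D         ≡⟨ ℤ.*-assoc (sign r) (+ A) (+ D) ⟩
  sign r * (+ A * + D)       ≡⟨ cong (sign r *_) (ℤ.pos-* A D) ⟨
  sign r * + (A ℕ.* D)       ≡⟨ cong (λ x → sign r * + x) (summand-numerator-identity k r) ⟩
  sign r * + (P ℕ.* Q ℕ.* E) ≡⟨ cong (sign r *_) (trans (ℤ.pos-* (P ℕ.* Q) E) (cong (_* + E) (ℤ.pos-* P Q))) ⟩
  sign r * (+ P * + Q * + E) ≡⟨ reassociate (sign r) (+ P) (+ Q) (+ E) ⟩
  sign r * + P * + Q * + E   ∎)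
  where
  open ≡-Reasoning
  A = (suc k C r) ℕ.* ((suc k ℕ.+ r) C r)
  D = suc k ℕ.* suc (suc k)
  P = (k ℕ.+ r) C r
  Q = suc (suc k) C suc r
  E = suc r ℕ.* suc (k ℕ.+ r)
  reassociate : ∀ s p q e → s * (p * q * e) ≡ s * p * q * e
  reassociate = ℤ-Solver.solve-∀

S-closed-form : ∀ k → S (suc k) ≡ (δ (suc k) + δ k) / (suc k ℕ.* suc (suc k))
S-closed-form k = begin
  sumTo (suc k) (term (suc k))
    ≡⟨ sumTo-cong (suc k) (term≡negBinomial*binomial/[k+1][k+2] k) ⟩
  sumTo (suc k) (λ r → (negBinomial k r * binomial (suc (suc k)) (suc r)) / (suc k ℕ.* suc (suc k)))
    ≡⟨ sumTo-/ (suc k) (λ r → negBinomial k r * binomial (suc (suc k)) (suc r)) (suc k ℕ.* suc (suc k)) ⟩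
  sumℤ (suc k) (λ r → negBinomial k r * binomial (suc (suc k)) (suc r)) / (suc k ℕ.* suc (suc k))
    ≡⟨ cong (_/ (suc k ℕ.* suc (suc k))) (sum-negBinomial-binomial k) ⟩
  (δ (suc k) + δ k) / (suc k ℕ.* suc (suc k)) ∎
  where open ≡-Reasoning

lemmaA3 : (m : ℕ) → .{{_ : NonZero m}} → (m ≡ 1 → S m ≡ ½) × (m ≥ 2 → S m ≡ 0ℚ)
lemmaA3 (suc zero)    = (λ _ → S-closed-form 0) , λ { (s≤s ()) }
lemmaA3 (suc (suc k)) = (λ ()) , λ _ → trans (S-closed-form (suc k)) (ℚ.0/n≡0 (suc (suc k) ℕ.* suc (suc (suc k))))
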